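{- For every fixed integer $\sigma \ge 2$, $\mathit{SQ}_{\mathrm{Abel}}(n,\sigma)=\Theta(n^2)$ as $n\to\infty$.
   Context: For a word $w$ and a letter $c$, $|w|_c$ denotes the number of occurrences of $c$ in $w$; for an ordered alphabet $\{0,\ldots,\sigma-1\}$ the Parikh vector of $w$ is $P(w)=(|w|_0,\ldots,|w|_{\sigma-1})$. An Abelian square is a word $uv$ with $u,v$ nonempty, $|u|=|v|$ and $P(u)=P(v)$. A subword of $w$ is a word $w[i]\cdots w[j]$ with $1\le i\le j\le |w|$. $\mathit{SQ}_{\mathrm{Abel}}(n,\sigma)$ is the maximum, over all words $w$ of length $n$ over an alphabet of size $\sigma$, of the number of subwords of $w$ that are Abelian squares, counted as distinct words. -}

module Defs where

open import Data.Nat using (ℕ; zero; suc; _⊔_; _≟_)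
import Data.Vec.Properties as VecP
open import Data.Fin using (Fin)
import Data.Fin as Fin
open import Data.Fin.Properties using () renaming (_≟_ to _≟ᶠ_)
open import Data.List using (List; []; _∷_; _++_; length; filter; map; concatMap; inits; tails; allFin; foldr; deduplicate)
open import Data.List.Properties using (≡-dec)
open import Data.Vec using (Vec; tabulate)
open import Data.Product using (Σ; _×_; _,_; ∃; ∃-syntax)
open import Relation.Binary.PropositionalEquality using (_≡_; _≢_; refl; cong)
open import Relation.Nullary using (Dec; yes; no; ¬_; ¬?)
open import Relation.Nullary.Decidable using (⌊_⌋; _×-dec_)

Word : ℕ → Set
Word σ = List (Fin σ)

occ : ∀ {σ} → Fin σ → Word σ → ℕ
occ c w = length (filter (c ≟ᶠ_) w)

parikh : ∀ {σ} → Word σ → Vec ℕ σ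
parikh w = tabulate (λ c → occ c w)

IsAbelianSquare : ∀ {σ} → Word σ → Set
IsAbelianSquare {σ} w =
  ∃[ u ] ∃[ v ] (w ≡ u ++ v) × (u ≢ []) × (v ≢ []) × (length u ≡ length v) × (parikh u ≡ parikh v)

private
  split-dec : ∀ {A : Set} (P : List A → List A → Set) → (∀ u v → Dec (P u v)) →
              ∀ w → Dec (∃[ u ] ∃[ v ] (w ≡ u ++ v) × P u v)
  split-dec P P? [] with P? [] []
  ... | yes p = yes ([] , [] , refl , p)
  ... | no ¬p = no λ { ([] , [] , refl , p) → ¬p p
                     ; ([] , _ ∷ _ , () , _)
                     ; (_ ∷ _ , _ , () , _) }
  split-dec P P? (x ∷ xs) with P? [] (x ∷ xs)
  ... | yes p = yes ([] , x ∷ xs , refl , p)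
  ... | no ¬p with split-dec (λ u v → P (x ∷ u) v) (λ u v → P? (x ∷ u) v) xs
  ...   | yes (u , v , eq , p) = yes (x ∷ u , v , cong (x ∷_) eq , p)
  ...   | no ¬q = no λ { ([] , v , refl , p) → ¬p p
                       ; (y ∷ u , v , refl , p) → ¬q (u , v , refl , p) }

isAbelianSquare? : ∀ {σ} (w : Word σ) → Dec (IsAbelianSquare w)
isAbelianSquare? {σ} w = split-dec _ cond? w
  where
  cond? : ∀ (u v : Word σ) → Dec ((u ≢ []) × (v ≢ []) × (length u ≡ length v) × (parikh u ≡ parikh v))
  cond? u v = ¬? (≡-dec _≟ᶠ_ u []) ×-dec ¬? (≡-dec _≟ᶠ_ v []) ×-dec (length u ≟ length v)
              ×-dec VecP.≡-dec _≟_ (parikh u) (parikh v)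

subwords : ∀ {σ} → Word σ → List (Word σ)
subwords w = concatMap nonemptyPrefixes (tails w)
  where
  nonemptyPrefixes : _ → List _
  nonemptyPrefixes t with inits t
  ... | [] = []
  ... | _ ∷ ps = ps

countAbelianSquares : ∀ {σ} → Word σ → ℕ
countAbelianSquares {σ} w =
  length (deduplicate (≡-dec _≟ᶠ_) (filter isAbelianSquare? (subwords w)))

wordsOfLength : ∀ σ → ℕ → List (Word σ)
wordsOfLength σ zero = [] ∷ []
wordsOfLength σ (suc n) = concatMap (λ c → map (c ∷_) (wordsOfLength σ n)) (allFin σ)

SQAbel : ℕ → ℕ → ℕ
SQAbel n σ = foldr _⊔_ 0 (map countAbelianSquares (wordsOfLength σ n))

module Submission where

-- Upper bound.  A word of length n has at most n² subword occurrences
-- (a starting point and a length), so at most n² distinct Abelian-square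
-- subwords; hence SQ_Abel(n, σ) ≤ n².
--
-- Fix two distinct letters 0 and 1 and put
--   W k r = 0^k 1 0^{2k} 1 0^{3k+r}      (length 6k + 2 + r).
-- For a, t ≤ k the subword  square k a t = 0^a 1 0^{2k} 1 0^{a+2t}  of W k r
-- is an Abelian square: with s = k - t it splits as
--   (0^a 1 0^{t+s+t}) (0^s 1 0^{a+2t}),
-- and both halves are rotations of 1 0^{a+2t+s}, so they have equal length and
-- equal Parikh vectors.  These (k+1)² words are pairwise distinct, so
-- SQ_Abel(6k+2+r, σ) ≥ (k+1)².  Writing n = 6k + 2 + r with r < 6 gives
-- n ≤ 7(k+1), hence n² ≤ 49 · SQ_Abel(n, σ) for all n ≥ 2.

open import Defs
open import Data.Nat using (ℕ; zero; suc; _+_; _*_; _^_; _∸_; _⊔_; _≤_; z≤n; s≤s; s≤s⁻¹; _/_; _%_)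
open import Data.Nat.Properties
open import Data.Nat.DivMod using (m≡m%n+[m/n]*n; m%n<n)
open import Data.Nat.Solver using (module +-*-Solver)
open import Data.List using (List; []; _∷_; _++_; length; filter; map; replicate; foldr; allFin; lookup)
open import Data.List.Base using (module Inits)
import Data.List.Properties as ListP
open import Data.List.Membership.Propositional using (_∈_)
open import Data.List.Membership.Propositional.Properties
open import Data.List.Relation.Unary.Any using (here; there; index; satisfied)
import Data.List.Relation.Unary.Any as Any
open import Data.List.Relation.Unary.Any.Properties using (lookup-index)
open import Data.Fin using (Fin; toℕ; combine; remQuot)
import Data.Fin as Fin
import Data.Fin.Properties as FinP
open import Data.Product using (∃-syntax; _×_; _,_; uncurry; map₁)
open import Data.Vec.Properties using (tabulate-cong)
open import Function using (_∘_)
open import Function.Definitions using (Injective)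
open import Relation.Binary.PropositionalEquality
open import Relation.Nullary using (contradiction)
open +-*-Solver

-- Note: by definition  subwords (x ∷ w) = Inits.tail (x ∷ w) ++ subwords w,
-- i.e. the nonempty prefixes of x ∷ w followed by the subwords of w.

length-nonemptyPrefixes : ∀ {A : Set} (xs : List A) → length (Inits.tail xs) ≡ length xs
length-nonemptyPrefixes [] = refl
length-nonemptyPrefixes (x ∷ xs) =
  cong suc (trans (ListP.length-map (x ∷_) (Inits.tail xs)) (length-nonemptyPrefixes xs))

prefix-∈-nonemptyPrefixes : ∀ {A : Set} (x : A) s q → x ∷ s ∈ Inits.tail (x ∷ s ++ q)
prefix-∈-nonemptyPrefixes x [] q = here refl
prefix-∈-nonemptyPrefixes x (y ∷ s) q = there (∈-map⁺ (x ∷_) (prefix-∈-nonemptyPrefixes y s q))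

length-subwords : ∀ {σ} (w : Word σ) → length (subwords w) ≤ length w * length w
length-subwords [] = z≤n
length-subwords (x ∷ w) = begin
  length (Inits.tail (x ∷ w) ++ subwords w)
    ≡⟨ ListP.length-++ (Inits.tail (x ∷ w)) ⟩
  length (Inits.tail (x ∷ w)) + length (subwords w)
    ≡⟨ cong (_+ length (subwords w)) (length-nonemptyPrefixes (x ∷ w)) ⟩
  suc m + length (subwords w)
    ≤⟨ +-monoʳ-≤ (suc m) (length-subwords w) ⟩
  suc m + m * m
    ≤⟨ +-monoʳ-≤ (suc m) (*-monoʳ-≤ m (n≤1+n m)) ⟩
  suc m * suc m ∎
  where
  open ≤-Reasoning
  m = length w

infix-∈-subwords : ∀ {σ} (p s q : Word σ) → s ≢ [] → s ∈ subwords (p ++ s ++ q)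
infix-∈-subwords [] [] q s≢[] = contradiction refl s≢[]
infix-∈-subwords [] (x ∷ s) q _ = ∈-++⁺ˡ (prefix-∈-nonemptyPrefixes x s q)
infix-∈-subwords (x ∷ p) s q s≢[] =
  ∈-++⁺ʳ (Inits.tail (x ∷ p ++ s ++ q)) (infix-∈-subwords p s q s≢[])

injection-≤-length : ∀ {A : Set} {m} {xs : List A} (g : Fin m → A) →
  Injective _≡_ _≡_ g → (∀ i → g i ∈ xs) → m ≤ length xs
injection-≤-length {xs = xs} g g-injective g∈xs = FinP.injective⇒≤ {f = position} position-injective
  where
  position : ∀ i → Fin (length xs)
  position i = index (g∈xs i)
  position-injective : Injective _≡_ _≡_ position
  position-injective {i} {j} same = g-injective (begin
    g i                    ≡⟨ lookup-index (g∈xs i) ⟩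
    lookup xs (position i) ≡⟨ cong (lookup xs) same ⟩
    lookup xs (position j) ≡⟨ lookup-index (g∈xs j) ⟨
    g j ∎)
    where open ≡-Reasoning

countAbelianSquares-≤ : ∀ {σ} (w : Word σ) → countAbelianSquares w ≤ length w * length w
countAbelianSquares-≤ w = begin
  countAbelianSquares w
    ≤⟨ ListP.length-deduplicate (ListP.≡-dec FinP._≟_) (filter isAbelianSquare? (subwords w)) ⟩
  length (filter isAbelianSquare? (subwords w))
    ≤⟨ ListP.length-filter isAbelianSquare? (subwords w) ⟩
  length (subwords w)
    ≤⟨ length-subwords w ⟩
  length w * length w ∎
  where open ≤-Reasoning

countAbelianSquares-≥ : ∀ {σ m} (w : Word σ) (g : Fin m → Word σ) → Injective _≡_ _≡_ g →
  (∀ i → IsAbelianSquare (g i)) → (∀ i → g i ∈ subwords w) → m ≤ countAbelianSquares w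
countAbelianSquares-≥ w g g-injective square sub = injection-≤-length g g-injective λ i →
  ∈-deduplicate⁺ (ListP.≡-dec FinP._≟_) (∈-filter⁺ isAbelianSquare? (sub i) (square i))

length-∈-wordsOfLength : ∀ {σ} n {w : Word σ} → w ∈ wordsOfLength σ n → length w ≡ n
length-∈-wordsOfLength zero (here refl) = refl
length-∈-wordsOfLength {σ} (suc n) w∈
  with satisfied (∈-concatMap⁻ (λ c → map (c ∷_) (wordsOfLength σ n)) {xs = allFin σ} w∈)
... | c , w∈c∷ with ∈-map⁻ (c ∷_) w∈c∷
... | w′ , w′∈ , refl = cong suc (length-∈-wordsOfLength n w′∈)

∈-wordsOfLength : ∀ {σ} (w : Word σ) → w ∈ wordsOfLength σ (length w)
∈-wordsOfLength [] = here refl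
∈-wordsOfLength {σ} (c ∷ w) = ∈-concatMap⁺ (λ c′ → map (c′ ∷_) (wordsOfLength σ (length w)))
  (Any.map (λ { refl → ∈-map⁺ (c ∷_) (∈-wordsOfLength w) }) (∈-allFin c))

foldr-⊔-lub : ∀ (xs : List ℕ) {B} → (∀ x → x ∈ xs → x ≤ B) → foldr _⊔_ 0 xs ≤ B
foldr-⊔-lub [] _ = z≤n
foldr-⊔-lub (x ∷ xs) bound = ⊔-lub (bound x (here refl)) (foldr-⊔-lub xs (λ y → bound y ∘ there))

foldr-⊔-upper : ∀ (xs : List ℕ) {x} → x ∈ xs → x ≤ foldr _⊔_ 0 xs
foldr-⊔-upper (y ∷ xs) (here refl) = m≤m⊔n y _
foldr-⊔-upper (y ∷ xs) (there x∈) = ≤-trans (foldr-⊔-upper xs x∈) (m≤n⊔m y _)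

SQAbel-≤ : ∀ n σ → SQAbel n σ ≤ n ^ 2
SQAbel-≤ n σ = foldr-⊔-lub (map countAbelianSquares (wordsOfLength σ n)) bound
  where
  bound : ∀ x → x ∈ map countAbelianSquares (wordsOfLength σ n) → x ≤ n ^ 2
  bound x x∈ with ∈-map⁻ countAbelianSquares x∈
  ... | w , w∈ , refl rewrite sym (length-∈-wordsOfLength n w∈) | *-identityʳ (length w) =
    countAbelianSquares-≤ w

SQAbel-≥-word : ∀ {σ} (w : Word σ) → countAbelianSquares w ≤ SQAbel (length w) σ
SQAbel-≥-word {σ} w =
  foldr-⊔-upper (map countAbelianSquares (wordsOfLength σ (length w)))
    (∈-map⁺ countAbelianSquares (∈-wordsOfLength w))

occ-++ : ∀ {σ} (c : Fin σ) xs ys → occ c (xs ++ ys) ≡ occ c xs + occ c ys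
occ-++ c xs ys =
  trans (cong length (ListP.filter-++ (c FinP.≟_) xs ys)) (ListP.length-++ (filter (c FinP.≟_) xs))

parikh-rotate : ∀ {σ} (xs ys : Word σ) → parikh (xs ++ ys) ≡ parikh (ys ++ xs)
parikh-rotate xs ys = tabulate-cong λ c → begin
  occ c (xs ++ ys)      ≡⟨ occ-++ c xs ys ⟩
  occ c xs + occ c ys   ≡⟨ +-comm (occ c xs) (occ c ys) ⟩
  occ c ys + occ c xs   ≡⟨ occ-++ c ys xs ⟨
  occ c (ys ++ xs) ∎
  where open ≡-Reasoning

module TwoLetters {σ} (𝟎 𝟏 : Fin σ) (𝟏≢𝟎 : 𝟏 ≢ 𝟎) where

  zeros : ℕ → Word σ
  zeros n = replicate n 𝟎

  zeros-+ : ∀ m n → zeros (m + n) ≡ zeros m ++ zeros n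
  zeros-+ zero n = refl
  zeros-+ (suc m) n = cong (𝟎 ∷_) (zeros-+ m n)

  length-zeros-++ : ∀ m (X : Word σ) → length (zeros m ++ X) ≡ m + length X
  length-zeros-++ m X = trans (ListP.length-++ (zeros m)) (cong (_+ length X) (ListP.length-replicate m))

  zeros-𝟏-nonempty : ∀ m X → zeros m ++ 𝟏 ∷ X ≢ []
  zeros-𝟏-nonempty zero X ()
  zeros-𝟏-nonempty (suc m) X ()

  zeros-𝟏-injective : ∀ m m′ (X X′ : Word σ) → zeros m ++ 𝟏 ∷ X ≡ zeros m′ ++ 𝟏 ∷ X′ → m ≡ m′ × X ≡ X′
  zeros-𝟏-injective zero zero X X′ eq = refl , ListP.∷-injectiveʳ eq
  zeros-𝟏-injective zero (suc m′) X X′ eq = contradiction (ListP.∷-injectiveˡ eq) 𝟏≢𝟎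
  zeros-𝟏-injective (suc m) zero X X′ eq = contradiction (sym (ListP.∷-injectiveˡ eq)) 𝟏≢𝟎
  zeros-𝟏-injective (suc m) (suc m′) X X′ eq =
    map₁ (cong suc) (zeros-𝟏-injective m m′ X X′ (ListP.∷-injectiveʳ eq))

  block : ℕ → ℕ → Word σ
  block m n = zeros m ++ 𝟏 ∷ zeros n

  -- block m n is a rotation of 1 0^{n+m}, so every rotation-invariant quantity
  -- (length, Parikh vector) of a block depends only on its number of zeros.
  block-invariant : ∀ {B : Set} (F : Word σ → B) → (∀ xs ys → F (xs ++ ys) ≡ F (ys ++ xs)) →
    ∀ {m n m′ n′} → n + m ≡ n′ + m′ → F (block m n) ≡ F (block m′ n′)
  block-invariant F rotate {m} {n} {m′} {n′} same-zeros = begin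
    F (block m n)                ≡⟨ rotate (zeros m) (𝟏 ∷ zeros n) ⟩
    F (𝟏 ∷ zeros n ++ zeros m)   ≡⟨ cong (F ∘ (𝟏 ∷_)) (zeros-+ n m) ⟨
    F (𝟏 ∷ zeros (n + m))        ≡⟨ cong (F ∘ (𝟏 ∷_) ∘ zeros) same-zeros ⟩
    F (𝟏 ∷ zeros (n′ + m′))      ≡⟨ cong (F ∘ (𝟏 ∷_)) (zeros-+ n′ m′) ⟩
    F (𝟏 ∷ zeros n′ ++ zeros m′) ≡⟨ rotate (zeros m′) (𝟏 ∷ zeros n′) ⟨
    F (block m′ n′) ∎
    where open ≡-Reasoning

  square : ℕ → ℕ → ℕ → Word σ
  square k a t = zeros a ++ 𝟏 ∷ zeros (2 * k) ++ 𝟏 ∷ zeros (a + 2 * t)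

  square-halves : ∀ a t s → square (t + s) a t ≡ block a (t + s + t) ++ block s (a + 2 * t)
  square-halves a t s = begin
    zeros a ++ 𝟏 ∷ zeros (2 * (t + s)) ++ X
      ≡⟨ cong (λ k → zeros a ++ 𝟏 ∷ zeros k ++ X)
              (solve 2 (λ t s → con 2 :* (t :+ s) := t :+ s :+ t :+ s) refl t s) ⟩
    zeros a ++ 𝟏 ∷ zeros (t + s + t + s) ++ X
      ≡⟨ cong (λ Y → zeros a ++ 𝟏 ∷ Y ++ X) (zeros-+ (t + s + t) s) ⟩
    zeros a ++ 𝟏 ∷ (zeros (t + s + t) ++ zeros s) ++ X
      ≡⟨ cong (λ Y → zeros a ++ 𝟏 ∷ Y) (ListP.++-assoc (zeros (t + s + t)) (zeros s) X) ⟩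
    zeros a ++ 𝟏 ∷ zeros (t + s + t) ++ zeros s ++ X
      ≡⟨ ListP.++-assoc (zeros a) (𝟏 ∷ zeros (t + s + t)) (zeros s ++ X) ⟨
    block a (t + s + t) ++ block s (a + 2 * t) ∎
    where
    open ≡-Reasoning
    X = 𝟏 ∷ zeros (a + 2 * t)

  -- For t ≤ k, square k a t is an Abelian square: both halves have a + 2t + (k - t) zeros.
  square-abelian : ∀ {k t} a → t ≤ k → IsAbelianSquare (square k a t)
  square-abelian {k} {t} a t≤k =
    subst (λ k → IsAbelianSquare (square k a t)) (m+[n∸m]≡n t≤k)
      ( block a (t + s + t) , block s (a + 2 * t) , square-halves a t s
      , zeros-𝟏-nonempty a _ , zeros-𝟏-nonempty s _
      , halves-agree length ListP.length-++-comm
      , halves-agree parikh parikh-rotate )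
    where
    s = k ∸ t
    balanced : t + s + t + a ≡ a + 2 * t + s
    balanced = solve 3 (λ a t s → t :+ s :+ t :+ a := a :+ con 2 :* t :+ s) refl a t s
    halves-agree : ∀ {B : Set} (F : Word σ → B) → (∀ xs ys → F (xs ++ ys) ≡ F (ys ++ xs)) →
      F (block a (t + s + t)) ≡ F (block s (a + 2 * t))
    halves-agree F rotate = block-invariant F rotate balanced

  square-injective : ∀ k a t a′ t′ → square k a t ≡ square k a′ t′ → a ≡ a′ × t ≡ t′
  square-injective k a t a′ t′ eq with zeros-𝟏-injective a a′ _ _ eq
  ... | refl , rest-eq = refl , *-cancelˡ-≡ t t′ 2 (+-cancelˡ-≡ a (2 * t) (2 * t′) (begin
    a + 2 * t                   ≡⟨ ListP.length-replicate (a + 2 * t) ⟨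
    length (zeros (a + 2 * t))  ≡⟨ cong length last-zeros ⟩
    length (zeros (a + 2 * t′)) ≡⟨ ListP.length-replicate (a + 2 * t′) ⟩
    a + 2 * t′ ∎))
    where
    open ≡-Reasoning
    last-zeros : zeros (a + 2 * t) ≡ zeros (a + 2 * t′)
    last-zeros = ListP.∷-injectiveʳ (ListP.++-cancelˡ (zeros (2 * k)) _ _ rest-eq)

  W : ℕ → ℕ → Word σ
  W k r = zeros k ++ 𝟏 ∷ zeros (2 * k) ++ 𝟏 ∷ zeros (3 * k + r)

  length-W : ∀ k r → length (W k r) ≡ 2 + (r + k * 6)
  length-W k r = begin
    length (W k r)
      ≡⟨ length-zeros-++ k _ ⟩
    k + suc (length (zeros (2 * k) ++ 𝟏 ∷ zeros (3 * k + r)))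
      ≡⟨ cong (λ l → k + suc l) (length-zeros-++ (2 * k) _) ⟩
    k + suc (2 * k + suc (length (zeros (3 * k + r))))
      ≡⟨ cong (λ l → k + suc (2 * k + suc l)) (ListP.length-replicate (3 * k + r)) ⟩
    k + suc (2 * k + suc (3 * k + r))
      ≡⟨ solve 2 (λ k r → k :+ (con 1 :+ (con 2 :* k :+ (con 1 :+ (con 3 :* k :+ r))))
                          := con 2 :+ (r :+ k :* con 6)) refl k r ⟩
    2 + (r + k * 6) ∎
    where open ≡-Reasoning

  W-decompose : ∀ {k} a b t s r → a + b ≡ k → t + s ≡ k →
    W k r ≡ zeros b ++ square k a t ++ zeros (b + 2 * s + r)
  W-decompose a b t s r refl t+s≡k = begin
    zeros (a + b) ++ 𝟏 ∷ M ++ 𝟏 ∷ zeros (3 * (a + b) + r)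
      ≡⟨ cong₂ (λ P Q → P ++ 𝟏 ∷ M ++ 𝟏 ∷ Q)
               (trans (cong zeros (+-comm a b)) (zeros-+ b a))
               (trans (cong zeros tail-length) (zeros-+ (a + 2 * t) D)) ⟩
    (zeros b ++ zeros a) ++ 𝟏 ∷ M ++ 𝟏 ∷ zeros (a + 2 * t) ++ zeros D
      ≡⟨ ListP.++-assoc (zeros b) (zeros a) _ ⟩
    zeros b ++ zeros a ++ 𝟏 ∷ M ++ 𝟏 ∷ zeros (a + 2 * t) ++ zeros D
      ≡⟨ cong (λ T → zeros b ++ zeros a ++ T)
              (ListP.++-assoc (𝟏 ∷ M) (𝟏 ∷ zeros (a + 2 * t)) (zeros D)) ⟨
    zeros b ++ zeros a ++ (𝟏 ∷ M ++ 𝟏 ∷ zeros (a + 2 * t)) ++ zeros D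
      ≡⟨ cong (zeros b ++_) (ListP.++-assoc (zeros a) (𝟏 ∷ M ++ 𝟏 ∷ zeros (a + 2 * t)) (zeros D)) ⟨
    zeros b ++ square (a + b) a t ++ zeros D ∎
    where
    open ≡-Reasoning
    M = zeros (2 * (a + b))
    D = b + 2 * s + r
    tail-length : 3 * (a + b) + r ≡ a + 2 * t + D
    tail-length = begin
      3 * (a + b) + r           ≡⟨ solve 3 (λ a b r → con 3 :* (a :+ b) :+ r
                                                    := a :+ b :+ con 2 :* (a :+ b) :+ r) refl a b r ⟩
      a + b + 2 * (a + b) + r   ≡⟨ cong (λ k → a + b + 2 * k + r) t+s≡k ⟨
      a + b + 2 * (t + s) + r   ≡⟨ solve 5 (λ a b t s r → a :+ b :+ con 2 :* (t :+ s) :+ r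
                                      := a :+ con 2 :* t :+ (b :+ con 2 :* s :+ r)) refl a b t s r ⟩
      a + 2 * t + D ∎

  square-∈-W : ∀ {k a t} r → a ≤ k → t ≤ k → square k a t ∈ subwords (W k r)
  square-∈-W {k} {a} {t} r a≤k t≤k =
    subst (λ w → square k a t ∈ subwords w)
      (sym (W-decompose a (k ∸ a) t (k ∸ t) r (m+[n∸m]≡n a≤k) (m+[n∸m]≡n t≤k)))
      (infix-∈-subwords (zeros (k ∸ a)) (square k a t) _ (zeros-𝟏-nonempty a _))

  W-count : ∀ k r → suc k * suc k ≤ countAbelianSquares (W k r)
  W-count k r = countAbelianSquares-≥ (W k r) (indexed ∘ remQuot (suc k))
    (λ eq → remQuot-injective (indexed-injective eq))
    (indexed-abelian ∘ remQuot (suc k))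
    (indexed-∈-W ∘ remQuot (suc k))
    where
    indexed : Fin (suc k) × Fin (suc k) → Word σ
    indexed (a , t) = square k (toℕ a) (toℕ t)
    indexed-injective : Injective _≡_ _≡_ indexed
    indexed-injective {a , t} {a′ , t′} eq with square-injective k _ _ _ _ eq
    ... | a≡a′ , t≡t′ = cong₂ _,_ (FinP.toℕ-injective a≡a′) (FinP.toℕ-injective t≡t′)
    indexed-abelian : ∀ at → IsAbelianSquare (indexed at)
    indexed-abelian (a , t) = square-abelian (toℕ a) (FinP.toℕ≤pred[n] t)
    indexed-∈-W : ∀ at → indexed at ∈ subwords (W k r)
    indexed-∈-W (a , t) = square-∈-W r (FinP.toℕ≤pred[n] a) (FinP.toℕ≤pred[n] t)
    remQuot-injective : Injective _≡_ _≡_ (remQuot {suc k} (suc k))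
    remQuot-injective {i} {j} eq = begin
      i                         ≡⟨ FinP.combine-remQuot {suc k} (suc k) i ⟨
      unpair (remQuot (suc k) i) ≡⟨ cong unpair eq ⟩
      unpair (remQuot (suc k) j) ≡⟨ FinP.combine-remQuot {suc k} (suc k) j ⟩
      j ∎
      where
      open ≡-Reasoning
      unpair : Fin (suc k) × Fin (suc k) → Fin (suc k * suc k)
      unpair = uncurry combine

SQAbel-≥ : ∀ σ′ n → 2 ≤ n → n ^ 2 ≤ 49 * SQAbel n (suc (suc σ′))
SQAbel-≥ σ′ n@(suc (suc m)) (s≤s (s≤s z≤n)) = begin
  n ^ 2                             ≤⟨ ^-monoˡ-≤ 2 n≤7[k+1] ⟩
  (7 * suc k) ^ 2                   ≡⟨ solve 1 (λ k → (con 7 :* (con 1 :+ k)) :^ 2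
                                                     := con 49 :* ((con 1 :+ k) :* (con 1 :+ k))) refl k ⟩
  49 * (suc k * suc k)              ≤⟨ *-monoʳ-≤ 49 (W-count k r) ⟩
  49 * countAbelianSquares (W k r)  ≤⟨ *-monoʳ-≤ 49 W-witness ⟩
  49 * SQAbel n σ ∎
  where
  open TwoLetters {suc (suc σ′)} Fin.zero (Fin.suc Fin.zero) (λ ())
  open ≤-Reasoning
  σ = suc (suc σ′)
  k = m / 6
  r = m % 6
  n≡6k+2+r : n ≡ 2 + (r + k * 6)
  n≡6k+2+r = cong (2 +_) (m≡m%n+[m/n]*n m 6)
  n≤7[k+1] : n ≤ 7 * suc k
  n≤7[k+1] = begin
    n                  ≡⟨ n≡6k+2+r ⟩
    2 + (r + k * 6)    ≤⟨ +-monoʳ-≤ 2 (+-monoˡ-≤ (k * 6) (s≤s⁻¹ (m%n<n m 6))) ⟩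
    2 + (5 + k * 6)    ≤⟨ m≤m+n (2 + (5 + k * 6)) k ⟩
    2 + (5 + k * 6) + k ≡⟨ solve 1 (λ k → con 2 :+ (con 5 :+ k :* con 6) :+ k := con 7 :* (con 1 :+ k)) refl k ⟩
    7 * suc k ∎
  W-witness : countAbelianSquares (W k r) ≤ SQAbel n σ
  W-witness = subst (λ l → countAbelianSquares (W k r) ≤ SQAbel l σ)
                (trans (length-W k r) (sym n≡6k+2+r)) (SQAbel-≥-word (W k r))

fact3 : ∀ (σ : ℕ) → 2 ≤ σ →
    ∃[ a ] ∃[ b ] ∃[ N ] (1 ≤ a) × (∀ n → N ≤ n → (n ^ 2 ≤ a * SQAbel n σ) × (SQAbel n σ ≤ b * n ^ 2))
fact3 σ@(suc (suc σ′)) (s≤s (s≤s z≤n)) = 49 , 1 , 2 , s≤s z≤n , λ n 2≤n →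
  SQAbel-≥ σ′ n 2≤n ,
  subst (SQAbel n σ ≤_) (sym (*-identityˡ (n ^ 2))) (SQAbel-≤ n σ)
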